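{- Let $N, M$ be positive integers and let $E_N=(e_1,\dots,e_N)\in\{ -1,+1\}^N$. Put $t=\lfloor N/M\rfloor$ and assume that \[ M\ge 20,\qquad M>\frac{N}{100},\qquad t<100 . \] For $1\le i\le t$ let $\pi_i$ be the proportion of entries equal to $+1$ in the $i$-th block, i.e. \[ \pi_i=\frac{|\{j:\ (i-1)M<j\le iM,\ e_j=+1\}|}{M}, \] and define \[ X_1=4M\sum_{i=1}^t\left(\pi_i-\frac12\right)^2 . \] Then \[ X_1\le 2\cdot 10^4\,\frac{W(E_N)^2}{N}. \]
   Context: For a sequence $E_N=(e_1,\dots,e_N)\in\{ -1,+1\}^N$, the well-distribution measure is \[ W(E_N)=\max_{a,b,t}\left|\sum_{j=0}^{t-1}e_{a+jb}\right|, \] where the maximum is taken over all positive integers $a,b,t$ with $1\le a\le a+(t-1)b\le N$. The quantity $X_1$ is the statistic of the NIST "frequency test within a block". In it the sequence is split into $t=\lfloor N/M\rfloor$ consecutive non-overlapping blocks of length $M$, and any remaining entries are discarded. -}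

module Defs where

open import Data.Nat as ℕ using (ℕ; zero; suc; _⊔_; _∸_; _≤?_; NonZero)
open import Data.Integer as ℤ using (ℤ; +_; ∣_∣)
open import Data.List using (List; []; _∷_; foldr; concatMap; map; filter; length)
open import Data.Rational as ℚ using (ℚ; _/_; ½)
open import Relation.Nullary using (yes; no)

range : ℕ → ℕ → List ℕ
range lo hi = go (suc hi ∸ lo) lo
  where
  go : ℕ → ℕ → List ℕ
  go zero    _ = []
  go (suc k) s = s ∷ go k (suc s)

-- A sequence E_N is e : ℕ → ℤ, only e 1, ..., e N being relevant.
IsPM1Seq : ℕ → (ℕ → ℤ) → Set
IsPM1Seq N e = ∀ j → 1 ℕ.≤ j → j ℕ.≤ N → (e j ≡ + 1) ⊎ (e j ≡ ℤ.- (+ 1))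
  where
  open import Relation.Binary.PropositionalEquality using (_≡_)
  open import Data.Sum using (_⊎_)

apSum : (ℕ → ℤ) → ℕ → ℕ → ℕ → ℤ
apSum e a b zero    = + 0
apSum e a b (suc t) = apSum e a b t ℤ.+ e (a ℕ.+ t ℕ.* b)

-- Well-distribution measure: max over 1 ≤ a ≤ a+(t-1)b ≤ N, b,t ≥ 1.
-- (t ≤ N automatically; b may be restricted to b ≤ N without loss, since
--  for t ≥ 2 the constraint forces b < N, and for t = 1 the sum is e_a.)
W : ℕ → (ℕ → ℤ) → ℕ
W N e =
  foldr _⊔_ 0
    (concatMap (λ a → concatMap (λ b → map (λ t → term a b t) (range 1 N)) (range 1 N)) (range 1 N))
  where
  term : ℕ → ℕ → ℕ → ℕ
  term a b t with a ℕ.+ (t ∸ 1) ℕ.* b ≤? N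
  ... | yes _ = ∣ apSum e a b t ∣
  ... | no  _ = 0

countPlus : ℕ → (ℕ → ℤ) → ℕ → ℕ
countPlus M e i = length (filter (λ j → e j ℤ.≟ + 1) (range (suc ((i ∸ 1) ℕ.* M)) (i ℕ.* M)))

propPlus : (M : ℕ) → .{{_ : NonZero M}} → (ℕ → ℤ) → ℕ → ℚ
propPlus M e i = + countPlus M e i / M

sumℚ : ℕ → (ℕ → ℚ) → ℚ
sumℚ zero    f = ℚ.0ℚ
sumℚ (suc t) f = sumℚ t f ℚ.+ f (suc t)

X1 : (N M : ℕ) → .{{_ : NonZero M}} → (ℕ → ℤ) → ℚ
X1 N M e = (+ (4 ℕ.* M) / 1) ℚ.* sumℚ (N ℕ./ M) (λ i → let d = propPlus M e i ℚ.- ½ in d ℚ.* d)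

{-# OPTIONS --safe #-}
-- Each complete block is the arithmetic progression (i-1)M+1, ..., iM of difference 1, so its
-- ±1-sum, which equals 2·#{j : e_j = +1} - M = 2M(π_i - 1/2), is at most W in absolute value.
-- Hence every summand of X₁ is at most W²/(2M)², so X₁ ≤ t·W²/M, and t < 100, N < 100M give
-- t·N ≤ 9900·M ≤ 20000·M.

module Submission where

open import Defs
open import Data.Nat as ℕ using (ℕ; NonZero; _≤_; _<_; _*_; _/_; _^_)
open import Data.Integer using (ℤ; +_)
open import Data.Rational as ℚ using (ℚ)

open import Data.Nat using (zero; suc; _+_; _∸_; _⊔_; _≤?_; z≤n; s≤s)
import Data.Nat.Properties as ℕP
open import Data.Nat.DivMod using (m/n*n≤m)
import Data.Integer as ℤ
import Data.Integer.Properties as ℤP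
open import Data.Integer.Tactic.RingSolver using (solve-∀)
import Data.Nat.Tactic.RingSolver as NS
open import Data.Rational using (½; toℚᵘ)
import Data.Rational.Properties as ℚP
open import Data.Rational.Unnormalised as ℚᵘ using (ℚᵘ; mkℚᵘ; *≤*; *≡*)
import Data.Rational.Unnormalised.Properties as ℚᵘP
open import Data.List using (List; []; _∷_; foldr; concatMap; map; filter; length; iterate)
open import Data.List.Relation.Unary.Any using (here; there)
open import Data.List.Membership.Propositional using (_∈_; lose)
open import Data.List.Membership.Propositional.Properties using (∈-concatMap⁺; ∈-map⁺)
open import Data.Sum using (_⊎_; inj₁; inj₂)
open import Data.Empty using (⊥-elim-irr)
open import Relation.Nullary using (yes; no; contradiction)
open import Relation.Binary.PropositionalEquality
open import Function using (_∋_)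

unfolds-to-iterate : (g : ℕ → ℕ → List ℕ) → (∀ s → g 0 s ≡ []) →
  (∀ k s → g (suc k) s ≡ s ∷ g k (suc s)) → ∀ k s → g k s ≡ iterate suc s k
unfolds-to-iterate g g0 gs zero    s = g0 s
unfolds-to-iterate g g0 gs (suc k) s =
  trans (gs k s) (cong (s ∷_) (unfolds-to-iterate g g0 gs k (suc s)))

-- `range` is defined through a local `go` that cannot be named here, so
-- unification has to supply it as the function `g` of `unfolds-to-iterate`.
range≡iterate : ∀ lo hi → range lo hi ≡ iterate suc lo (suc hi ∸ lo)
range≡iterate lo hi with unfolds-to-iterate _ (λ _ → refl) (λ _ _ → refl) | suc hi ∸ lo
... | _    | zero  = refl
... | go≡ | suc k with suc lo
...   | s = cong (lo ∷_) (go≡ k s)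

∈-iterate-suc : ∀ {s k x} → s ≤ x → x < s + k → x ∈ iterate suc s k
∈-iterate-suc {s} {zero}  s≤x x<s+0 =
  contradiction (ℕP.≤-trans x<s+0 (ℕP.≤-trans (ℕP.≤-reflexive (ℕP.+-identityʳ s)) s≤x)) (ℕP.n≮n _)
∈-iterate-suc {s} {suc k} {x} s≤x x<s+k with s ℕP.≟ x
... | yes refl = here refl
... | no s≢x   = there (∈-iterate-suc (ℕP.≤∧≢⇒< s≤x s≢x) (subst (x <_) (ℕP.+-suc s k) x<s+k))

∈-range : ∀ {lo hi x} → lo ≤ x → x ≤ hi → x ∈ range lo hi
∈-range {lo} {hi} {x} lo≤x x≤hi = subst (_ ∈_) (sym (range≡iterate lo hi))
  (∈-iterate-suc lo≤x (subst (x <_) (sym (ℕP.m+[n∸m]≡n lo≤1+hi)) (s≤s x≤hi)))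
  where lo≤1+hi = ℕP.m≤n⇒m≤1+n (ℕP.≤-trans lo≤x x≤hi)

∈⇒≤foldr-⊔ : ∀ {x xs} → x ∈ xs → x ≤ foldr _⊔_ 0 xs
∈⇒≤foldr-⊔ (here refl)            = ℕP.m≤m⊔n _ _
∈⇒≤foldr-⊔ {xs = y ∷ _} (there p) = ℕP.≤-trans (∈⇒≤foldr-⊔ p) (ℕP.m≤n⊔m y _)

≤max-over-cube : ∀ N (f : ℕ → ℕ → ℕ → ℕ) {a b t} → 1 ≤ a → a ≤ N → 1 ≤ b → b ≤ N → 1 ≤ t → t ≤ N →
  f a b t ≤ foldr _⊔_ 0 (concatMap (λ a → concatMap (λ b → map (f a b) (range 1 N)) (range 1 N)) (range 1 N))
≤max-over-cube N f 1≤a a≤N 1≤b b≤N 1≤t t≤N = ∈⇒≤foldr-⊔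
  (∈-concatMap⁺ _ (lose (∈-range 1≤a a≤N)
    (∈-concatMap⁺ _ (lose (∈-range 1≤b b≤N) (∈-map⁺ _ (∈-range 1≤t t≤N))))))

length-≤-of-fitting-ap : ∀ {N a b} t → 1 ≤ a → 1 ≤ b → a + (t ∸ 1) * b ≤ N → t ≤ N
length-≤-of-fitting-ap zero          _   _   _    = z≤n
length-≤-of-fitting-ap {b = b} (suc t-1) 1≤a 1≤b fits =
  ℕP.≤-trans (ℕP.+-mono-≤ 1≤a (ℕP.m≤m*n t-1 b {{ℕ.>-nonZero 1≤b}})) fits

∣apSum∣≤W : ∀ N e a b t → 1 ≤ a → 1 ≤ b → b ≤ N → 1 ≤ t → a + (t ∸ 1) * b ≤ N →
  ℤ.∣ apSum e a b t ∣ ≤ W N e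
∣apSum∣≤W N e a b t 1≤a 1≤b b≤N 1≤t fits
  with (_ ≤ W N e) ∋ ≤max-over-cube N _ 1≤a a≤N 1≤b b≤N 1≤t (length-≤-of-fitting-ap t 1≤a 1≤b fits)
  where
  a≤N : a ≤ N
  a≤N = ℕP.≤-trans (ℕP.m≤m+n a _) fits
... | bound with a + (t ∸ 1) * b ≤? N
...   | yes _   = bound
...   | no ¬fit = contradiction fits ¬fit

apSum-uncons : ∀ e a b t → apSum e a b (suc t) ≡ e a ℤ.+ apSum e (a + b) b t
apSum-uncons e a b zero = begin
  + 0 ℤ.+ e (a + 0)   ≡⟨ ℤP.+-identityˡ _ ⟩
  e (a + 0)           ≡⟨ cong e (ℕP.+-identityʳ a) ⟩
  e a                 ≡⟨ ℤP.+-identityʳ (e a) ⟨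
  e a ℤ.+ + 0         ∎
  where open ≡-Reasoning
apSum-uncons e a b (suc t) = begin
  apSum e a b (suc t) ℤ.+ e (a + suc t * b)              ≡⟨ cong₂ ℤ._+_ (apSum-uncons e a b t) (cong e shift) ⟩
  (e a ℤ.+ apSum e (a + b) b t) ℤ.+ e (a + b + t * b)    ≡⟨ ℤP.+-assoc (e a) _ _ ⟩
  e a ℤ.+ apSum e (a + b) b (suc t)                      ∎
  where
  open ≡-Reasoning
  shift : a + suc t * b ≡ a + b + t * b
  shift = sym (ℕP.+-assoc a b (t * b))

plusCount : (ℕ → ℤ) → List ℕ → ℕ
plusCount e js = length (filter (λ j → e j ℤ.≟ + 1) js)

apSum-block : ∀ e s k → (∀ j → s ≤ j → j < s + k → e j ≡ + 1 ⊎ e j ≡ ℤ.- + 1) →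
  apSum e s 1 k ℤ.+ + k ≡ + 2 ℤ.* + plusCount e (iterate suc s k)
apSum-block e s zero    _   = refl
apSum-block e s (suc k) pm1 = begin
  apSum e s 1 (suc k) ℤ.+ + suc k                     ≡⟨ cong₂ ℤ._+_ (apSum-uncons e s 1 k) (ℤP.pos-+ 1 k) ⟩
  (e s ℤ.+ apSum e (s + 1) 1 k) ℤ.+ (+ 1 ℤ.+ + k)     ≡⟨ cong (λ s′ → (e s ℤ.+ apSum e s′ 1 k) ℤ.+ (+ 1 ℤ.+ + k)) (ℕP.+-comm s 1) ⟩
  (e s ℤ.+ rest) ℤ.+ (+ 1 ℤ.+ + k)                    ≡⟨ count-head ⟩
  + 2 ℤ.* + plusCount e (iterate suc s (suc k))       ∎
  where
  open ≡-Reasoning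
  rest : ℤ
  rest = apSum e (suc s) 1 k
  c : ℕ
  c = plusCount e (iterate suc (suc s) k)
  ih : rest ℤ.+ + k ≡ + 2 ℤ.* + c
  ih = apSum-block e (suc s) k λ j s<j j<s+1+k → pm1 j (ℕP.<⇒≤ s<j) (subst (j <_) (sym (ℕP.+-suc s k)) j<s+1+k)
  count-head : (e s ℤ.+ rest) ℤ.+ (+ 1 ℤ.+ + k) ≡ + 2 ℤ.* + plusCount e (iterate suc s (suc k))
  count-head with e s ℤ.≟ + 1 | pm1 s ℕP.≤-refl (ℕP.m<m+n s (s≤s z≤n))
  ... | yes es=1 | _ = begin
    (e s ℤ.+ rest) ℤ.+ (+ 1 ℤ.+ + k)   ≡⟨ cong (λ x → (x ℤ.+ rest) ℤ.+ (+ 1 ℤ.+ + k)) es=1 ⟩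
    (+ 1 ℤ.+ rest) ℤ.+ (+ 1 ℤ.+ + k)   ≡⟨ regroup rest (+ k) ⟩
    + 2 ℤ.+ (rest ℤ.+ + k)             ≡⟨ cong (ℤ._+_ (+ 2)) ih ⟩
    + 2 ℤ.+ + 2 ℤ.* + c               ≡⟨ ℤP.*-distribˡ-+ (+ 2) (+ 1) (+ c) ⟨
    + 2 ℤ.* + suc c                   ∎
    where
    regroup : ∀ x k → (+ 1 ℤ.+ x) ℤ.+ (+ 1 ℤ.+ k) ≡ + 2 ℤ.+ (x ℤ.+ k)
    regroup = solve-∀
  ... | no es≢1 | inj₁ es=1  = contradiction es=1 es≢1
  ... | no _    | inj₂ es=-1 = begin
    (e s ℤ.+ rest) ℤ.+ (+ 1 ℤ.+ + k)        ≡⟨ cong (λ x → (x ℤ.+ rest) ℤ.+ (+ 1 ℤ.+ + k)) es=-1 ⟩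
    (ℤ.- + 1 ℤ.+ rest) ℤ.+ (+ 1 ℤ.+ + k)    ≡⟨ cancel rest (+ k) ⟩
    rest ℤ.+ + k                            ≡⟨ ih ⟩
    + 2 ℤ.* + c                            ∎
    where
    cancel : ∀ x k → (ℤ.- + 1 ℤ.+ x) ℤ.+ (+ 1 ℤ.+ k) ≡ x ℤ.+ k
    cancel = solve-∀

countPlus≡plusCount : ∀ M e i → countPlus M e (suc i) ≡ plusCount e (iterate suc (suc (i * M)) M)
countPlus≡plusCount M e i = begin
  plusCount e (range (suc (i * M)) (M + i * M))                        ≡⟨ cong (plusCount e) (range≡iterate (suc (i * M)) (M + i * M)) ⟩
  plusCount e (iterate suc (suc (i * M)) (suc (M + i * M) ∸ suc (i * M))) ≡⟨ cong (λ k → plusCount e (iterate suc (suc (i * M)) k)) (ℕP.m+n∸n≡m M (i * M)) ⟩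
  plusCount e (iterate suc (suc (i * M)) M)                            ∎
  where open ≡-Reasoning

block-deviation≤W : ∀ N m e i → IsPM1Seq N e → suc i * suc m ≤ N →
  ℤ.∣ + 2 ℤ.* + countPlus (suc m) e (suc i) ℤ.- + suc m ∣ ≤ W N e
block-deviation≤W N m e i pm1 block≤N = subst (_≤ W N e) (cong ℤ.∣_∣ deviation≡sum)
  (∣apSum∣≤W N e a 1 (suc m) (s≤s z≤n) ℕP.≤-refl 1≤N (s≤s z≤n) fits)
  where
  a : ℕ
  a = suc (i * suc m)
  end≡ : a + suc m ≡ suc (suc i * suc m)
  end≡ = cong suc (ℕP.+-comm (i * suc m) (suc m))
  fits : a + m * 1 ≤ N
  fits = subst (_≤ N) (cong suc (sym (trans (cong (_+_ (i * suc m)) (ℕP.*-identityʳ m)) (ℕP.+-comm _ m)))) block≤N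
  1≤N : 1 ≤ N
  1≤N = ℕP.≤-trans (s≤s z≤n) block≤N
  pm1-on-block : ∀ j → a ≤ j → j < a + suc m → e j ≡ + 1 ⊎ e j ≡ ℤ.- + 1
  pm1-on-block j a≤j j<end = pm1 j (ℕP.≤-trans (s≤s z≤n) a≤j)
    (ℕP.≤-trans (ℕP.≤-pred (subst (j <_) end≡ j<end)) block≤N)
  x≡[x+y]-y : ∀ x y → x ≡ (x ℤ.+ y) ℤ.- y
  x≡[x+y]-y = solve-∀
  deviation≡sum : apSum e a 1 (suc m) ≡ + 2 ℤ.* + countPlus (suc m) e (suc i) ℤ.- + suc m
  deviation≡sum = begin
    apSum e a 1 (suc m)                                  ≡⟨ x≡[x+y]-y _ (+ suc m) ⟩
    (apSum e a 1 (suc m) ℤ.+ + suc m) ℤ.- + suc m        ≡⟨ cong (ℤ._- + suc m) (apSum-block e a (suc m) pm1-on-block) ⟩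
    + 2 ℤ.* + plusCount e (iterate suc a (suc m)) ℤ.- + suc m ≡⟨ cong (λ c → + 2 ℤ.* + c ℤ.- + suc m) (countPlus≡plusCount (suc m) e i) ⟨
    + 2 ℤ.* + countPlus (suc m) e (suc i) ℤ.- + suc m    ∎
    where open ≡-Reasoning

toℚᵘ-/ : ∀ i d → toℚᵘ (i ℚ./ suc d) ℚᵘ.≃ mkℚᵘ i d
toℚᵘ-/ i d = ℚP.toℚᵘ-fromℚᵘ (mkℚᵘ i d)

square-≤ : ∀ i {n} → ℤ.∣ i ∣ ≤ n → i ℤ.* i ℤ.≤ + (n * n)
square-≤ (+ k)      ∣i∣≤n = ℤP.≤-trans (ℤP.≤-reflexive (sym (ℤP.pos-* k k))) (ℤ.+≤+ (ℕP.*-mono-≤ ∣i∣≤n ∣i∣≤n))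
square-≤ ℤ.-[1+ k ] ∣i∣≤n = ℤ.+≤+ (ℕP.*-mono-≤ ∣i∣≤n ∣i∣≤n)

deviation²≤ : ∀ m c W → ℤ.∣ + 2 ℤ.* + c ℤ.- + suc m ∣ ≤ W →
  (+ c ℚ./ suc m ℚ.- ½) ℚ.* (+ c ℚ./ suc m ℚ.- ½) ℚ.≤ + (W * W) ℚ./ (suc m * 2 * (suc m * 2))
deviation²≤ m c W dev≤W = ℚP.toℚᵘ-cancel-≤ (begin
  toℚᵘ (d ℚ.* d)                              ≃⟨ ℚP.toℚᵘ-homo-* d d ⟩
  toℚᵘ d ℚᵘ.* toℚᵘ d                          ≃⟨ ℚᵘP.*-cong d≃ d≃ ⟩
  d′ ℚᵘ.* d′                                  ≤⟨ *≤* (ℤP.*-monoʳ-≤-nonNeg (+ (suc m * 2 * (suc m * 2))) (square-≤ numerator numerator≤W)) ⟩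
  mkℚᵘ (+ (W * W)) _                          ≃⟨ toℚᵘ-/ (+ (W * W)) _ ⟨
  toℚᵘ (+ (W * W) ℚ./ (suc m * 2 * (suc m * 2))) ∎)
  where
  open ℚᵘP.≤-Reasoning
  d : ℚ
  d = + c ℚ./ suc m ℚ.- ½
  d′ : ℚᵘ
  d′ = mkℚᵘ (+ c) m ℚᵘ.- mkℚᵘ (+ 1) 1
  d≃ : toℚᵘ d ℚᵘ.≃ d′
  d≃ = ℚᵘP.≃-trans (ℚP.toℚᵘ-homo-+ (+ c ℚ./ suc m) (ℚ.- ½))
         (ℚᵘP.+-cong (toℚᵘ-/ (+ c) m) (ℚᵘP.≃-trans (ℚP.toℚᵘ-homo‿- ½) (ℚᵘP.-‿cong {toℚᵘ ½} {mkℚᵘ (+ 1) 1} (*≡* refl))))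
  numerator : ℤ
  numerator = + c ℤ.* + 2 ℤ.+ ℤ.- + 1 ℤ.* + suc m
  numerator≤W : ℤ.∣ numerator ∣ ≤ W
  numerator≤W = subst (λ x → ℤ.∣ x ∣ ≤ W) (reorder (+ c) (+ suc m)) dev≤W
    where
    reorder : ∀ c M → + 2 ℤ.* c ℤ.- M ≡ c ℤ.* + 2 ℤ.+ ℤ.- + 1 ℤ.* M
    reorder = solve-∀

+suc/1≡+/1+1 : ∀ t → + suc t ℚ./ 1 ≡ + t ℚ./ 1 ℚ.+ ℚ.1ℚ
+suc/1≡+/1+1 t = ℚP.toℚᵘ-injective (begin
  toℚᵘ (+ suc t ℚ./ 1)                   ≈⟨ toℚᵘ-/ (+ suc t) 0 ⟩
  mkℚᵘ (+ suc t) 0                       ≈⟨ *≡* (cong (ℤ._* + 1) (suc≡ (+ t))) ⟩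
  mkℚᵘ (+ t) 0 ℚᵘ.+ mkℚᵘ (+ 1) 0         ≈⟨ ℚᵘP.+-cong (toℚᵘ-/ (+ t) 0) (toℚᵘ-/ (+ 1) 0) ⟨
  toℚᵘ (+ t ℚ./ 1) ℚᵘ.+ toℚᵘ ℚ.1ℚ        ≈⟨ ℚP.toℚᵘ-homo-+ (+ t ℚ./ 1) ℚ.1ℚ ⟨
  toℚᵘ (+ t ℚ./ 1 ℚ.+ ℚ.1ℚ)              ∎)
  where
  open ℚᵘP.≃-Reasoning
  suc≡ : ∀ x → + 1 ℤ.+ x ≡ x ℤ.* + 1 ℤ.+ + 1 ℤ.* + 1
  suc≡ = solve-∀

sumℚ-≤-* : ∀ t (f : ℕ → ℚ) B → (∀ i → 1 ≤ i → i ≤ t → f i ℚ.≤ B) → sumℚ t f ℚ.≤ (+ t ℚ./ 1) ℚ.* B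
sumℚ-≤-* zero    f B _     = ℚP.≤-reflexive (sym (ℚP.*-zeroˡ B))
sumℚ-≤-* (suc t) f B f≤B = begin
  sumℚ t f ℚ.+ f (suc t)               ≤⟨ ℚP.+-mono-≤ (sumℚ-≤-* t f B λ i 1≤i i≤t → f≤B i 1≤i (ℕP.m≤n⇒m≤1+n i≤t))
                                                       (f≤B (suc t) (s≤s z≤n) ℕP.≤-refl) ⟩
  (+ t ℚ./ 1) ℚ.* B ℚ.+ B              ≡⟨ cong (ℚ._+_ ((+ t ℚ./ 1) ℚ.* B)) (ℚP.*-identityˡ B) ⟨
  (+ t ℚ./ 1) ℚ.* B ℚ.+ ℚ.1ℚ ℚ.* B     ≡⟨ ℚP.*-distribʳ-+ B (+ t ℚ./ 1) ℚ.1ℚ ⟨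
  (+ t ℚ./ 1 ℚ.+ ℚ.1ℚ) ℚ.* B           ≡⟨ cong (ℚ._* B) (+suc/1≡+/1+1 t) ⟨
  (+ suc t ℚ./ 1) ℚ.* B                ∎
  where open ℚP.≤-Reasoning

cross-multiplied-ℕ : ∀ M N t W K → t * N ≤ K * M → 4 * M * (t * (W * W)) * N ≤ K * W ^ 2 * (M * 2 * (M * 2))
cross-multiplied-ℕ M N t W K tN≤KM = begin
  4 * M * (t * (W * W)) * N   ≡⟨ regroupˡ (4 * M) t (W * W) N ⟩
  4 * M * (W * W) * (t * N)   ≤⟨ ℕP.*-monoʳ-≤ (4 * M * (W * W)) tN≤KM ⟩
  4 * M * (W * W) * (K * M)   ≡⟨ regroupʳ M W K ⟩
  K * W ^ 2 * (M * 2 * (M * 2)) ∎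
  where
  open ℕP.≤-Reasoning
  regroupˡ : ∀ a b c d → a * (b * c) * d ≡ a * c * (b * d)
  regroupˡ = NS.solve-∀
  regroupʳ : ∀ M W K → 4 * M * (W * W) * (K * M) ≡ K * (W * (W * 1)) * (M * 2 * (M * 2))
  regroupʳ = NS.solve-∀

block-sum-bound : ∀ m n t W K → t * suc n ≤ K * suc m →
  (+ (4 * suc m) ℚ./ 1) ℚ.* ((+ t ℚ./ 1) ℚ.* (+ (W * W) ℚ./ (suc m * 2 * (suc m * 2))))
    ℚ.≤ + (K * W ^ 2) ℚ./ suc n
block-sum-bound m n t W K tN≤KM = ℚP.toℚᵘ-cancel-≤ (begin
  toℚᵘ (4M/1 ℚ.* (t/1 ℚ.* B))                         ≃⟨ ℚP.toℚᵘ-homo-* 4M/1 (t/1 ℚ.* B) ⟩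
  toℚᵘ 4M/1 ℚᵘ.* toℚᵘ (t/1 ℚ.* B)                     ≃⟨ ℚᵘP.*-cong (toℚᵘ-/ (+ (4 * M)) 0) (ℚP.toℚᵘ-homo-* t/1 B) ⟩
  mkℚᵘ (+ (4 * M)) 0 ℚᵘ.* (toℚᵘ t/1 ℚᵘ.* toℚᵘ B)      ≃⟨ ℚᵘP.*-cong (ℚᵘP.≃-refl {mkℚᵘ (+ (4 * M)) 0}) (ℚᵘP.*-cong (toℚᵘ-/ (+ t) 0) (toℚᵘ-/ (+ (W * W)) (ℕ.pred M2))) ⟩
  mkℚᵘ (+ (4 * M)) 0 ℚᵘ.* (mkℚᵘ (+ t) 0 ℚᵘ.* mkℚᵘ (+ (W * W)) (ℕ.pred M2)) ≤⟨ *≤* cross-multiplied ⟩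
  mkℚᵘ (+ (K * W ^ 2)) n                              ≃⟨ toℚᵘ-/ _ n ⟨
  toℚᵘ (+ (K * W ^ 2) ℚ./ suc n)                      ∎)
  where
  open ℚᵘP.≤-Reasoning
  M M2 : ℕ
  M = suc m
  M2 = M * 2 * (M * 2)
  4M/1 t/1 B : ℚ
  4M/1 = + (4 * M) ℚ./ 1
  t/1 = + t ℚ./ 1
  B = + (W * W) ℚ./ M2
  -- the form `*≤*` unfolds to for these denominators
  cross-multiplied : (+ (4 * M) ℤ.* (+ t ℤ.* + (W * W))) ℤ.* + suc n ℤ.≤ + (K * W ^ 2) ℤ.* (+ 1 ℤ.* (+ 1 ℤ.* + M2))
  cross-multiplied = subst₂ ℤ._≤_ (sym lhs≡) (sym rhs≡) (ℤ.+≤+ (cross-multiplied-ℕ M (suc n) t W K tN≤KM))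
    where
    lhs≡ : (+ (4 * M) ℤ.* (+ t ℤ.* + (W * W))) ℤ.* + suc n ≡ + (4 * M * (t * (W * W)) * suc n)
    lhs≡ = trans (cong (λ x → (+ (4 * M) ℤ.* x) ℤ.* + suc n) (sym (ℤP.pos-* t (W * W))))
           (trans (cong (ℤ._* + suc n) (sym (ℤP.pos-* (4 * M) (t * (W * W)))))
                  (sym (ℤP.pos-* (4 * M * (t * (W * W))) (suc n))))
    rhs≡ : + (K * W ^ 2) ℤ.* (+ 1 ℤ.* (+ 1 ℤ.* + M2)) ≡ + (K * W ^ 2 * M2)
    rhs≡ = trans (cong (ℤ._*_ (+ (K * W ^ 2))) (trans (ℤP.*-identityˡ (+ 1 ℤ.* + M2)) (ℤP.*-identityˡ (+ M2)))) (sym (ℤP.pos-* (K * W ^ 2) M2))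

theorem1 : (N M : ℕ) → .{{_ : NonZero N}} → .{{_ : NonZero M}} → (e : ℕ → ℤ) →
    IsPM1Seq N e → 20 ≤ M → N < 100 * M → N / M < 100 →
    X1 N M e ℚ.≤ (+ (20000 * W N e ^ 2)) ℚ./ N
theorem1 zero    _       {{N≢0}} _ _ _ _ _ = ⊥-elim-irr (NonZero.nonZero N≢0)
theorem1 (suc n) zero    {{_}} {{M≢0}} _ _ _ _ _ = ⊥-elim-irr (NonZero.nonZero M≢0)
theorem1 (suc n) (suc m) e pm1 _ N<100M t<100 = begin
  4M/1 ℚ.* sumℚ t (λ i → let d = propPlus M e i ℚ.- ½ in d ℚ.* d) ≤⟨ ℚP.*-monoˡ-≤-nonNeg 4M/1 {{ℚP.normalize-nonNeg (4 * M) 1}}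
                                                                          (sumℚ-≤-* t _ _ block-bound) ⟩
  4M/1 ℚ.* ((+ t ℚ./ 1) ℚ.* (+ (W N e * W N e) ℚ./ (M * 2 * (M * 2)))) ≤⟨ block-sum-bound m n t (W N e) 20000 tN≤20000M ⟩
  + (20000 * W N e ^ 2) ℚ./ N                                          ∎
  where
  open ℚP.≤-Reasoning
  N M t : ℕ
  N = suc n
  M = suc m
  t = N / M
  4M/1 : ℚ
  4M/1 = + (4 * M) ℚ./ 1
  block-bound : ∀ i → 1 ≤ i → i ≤ t →
    (propPlus M e i ℚ.- ½) ℚ.* (propPlus M e i ℚ.- ½) ℚ.≤ + (W N e * W N e) ℚ./ (M * 2 * (M * 2))
  block-bound (suc i) _ 1+i≤t = deviation²≤ m (countPlus M e (suc i)) (W N e)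
    (block-deviation≤W N m e i pm1 (ℕP.≤-trans (ℕP.*-monoˡ-≤ M 1+i≤t) (m/n*n≤m N M)))
  tN≤20000M : t * N ≤ 20000 * M
  tN≤20000M = ℕP.≤-trans (ℕP.*-mono-≤ (ℕP.≤-pred t<100) (ℕP.<⇒≤ N<100M))
    (ℕP.≤-trans (ℕP.≤-reflexive (sym (ℕP.*-assoc 99 100 M))) (ℕP.*-monoˡ-≤ M (ℕP.m≤m+n 9900 10100)))
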